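{- Let $n\ge 3$ and $k\ge 2$ be integers. Let $G_i=P_{2i+3}$ for all $i\in\{0,1,\ldots,n-2\}$ and let $G_{n-1}\in\{C_{2n},P_{2n+1}\}$. Let $i_1,\ldots,i_k$ be integers with $n-1\ge i_1\ge i_2\ge\cdots\ge i_k\ge 0$. Then $$GR(G_{i_1},\ldots,G_{i_k})\ \ge\ |G_{i_1}|+\sum_{j=2}^k i_j .$$
   Context: $P_m$, $C_m$, $K_m$ denote the path, cycle and complete graph on $m$ vertices; $|H|$ is the number of vertices of a graph $H$. A Gallai coloring is a coloring of the edges of a complete graph with no rainbow triangle (a triangle whose three edges receive three distinct colors); a Gallai $k$-coloring is a Gallai coloring using at most $k$ colors (colors $1,\ldots,k$). For graphs $H_1,\ldots,H_k$, the Gallai-Ramsey number $GR(H_1,\ldots,H_k)$ is the least integer $N$ such that every Gallai $k$-coloring of $K_N$ contains, for some $i\in\{1,\ldots,k\}$, a copy of $H_i$ all of whose edges have color $i$. -}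

module Defs where

open import Data.Nat using (ℕ; zero; suc; _+_; _*_; _∸_; _≤_; _<_)
open import Data.Nat.Properties using (_<?_)
open import Data.Fin using (Fin; toℕ) renaming (zero to fzero; suc to fsuc)
open import Data.Bool using (Bool; true; false; if_then_else_)
open import Data.Product using (Σ; ∃; _×_; _,_)
open import Data.Sum using (_⊎_)
open import Data.List using (List; sum; tabulate)
open import Relation.Nullary using (¬_; does)
open import Relation.Binary.PropositionalEquality using (_≡_; _≢_)
open import Function.Definitions using (Injective)

record Graph : Set₁ where
  field
    order : ℕ
    Edge  : Fin order → Fin order → Set
open Graph public

Path : ℕ → Graph
Path m = record { order = m
                ; Edge = λ u v → (toℕ v ≡ suc (toℕ u)) ⊎ (toℕ u ≡ suc (toℕ v)) }

-- Cycle C_m (used with m ≥ 3): path edges plus the edge {0, m-1}.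
Cycle : ℕ → Graph
Cycle m = record { order = m
                 ; Edge = λ u v → ((toℕ v ≡ suc (toℕ u)) ⊎ (toℕ u ≡ suc (toℕ v)))
                                  ⊎ ((toℕ u ≡ 0 × toℕ v ≡ m ∸ 1) ⊎ (toℕ v ≡ 0 × toℕ u ≡ m ∸ 1)) }

-- An edge coloring of K_N with colors Fin k: a symmetric function on pairs
-- (values on the diagonal are irrelevant).
record Coloring (N k : ℕ) : Set where
  field
    col : Fin N → Fin N → Fin k
    sym : ∀ x y → col x y ≡ col y x
open Coloring public

Gallai : ∀ {N k} → Coloring N k → Set
Gallai {N} c = ¬ (Σ (Fin N) λ x → Σ (Fin N) λ y → Σ (Fin N) λ z →
                   x ≢ y × y ≢ z × x ≢ z ×
                   col c x y ≢ col c y z × col c y z ≢ col c x z × col c x y ≢ col c x z)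

MonoCopy : ∀ {N k} → Coloring N k → Fin k → Graph → Set
MonoCopy {N} c i H = Σ (Fin (order H) → Fin N) λ f →
  Injective _≡_ _≡_ f × (∀ u v → Edge H u v → col c (f u) (f v) ≡ i)

GRProperty : ∀ {k} → (Fin k → Graph) → ℕ → Set
GRProperty {k} H N = (c : Coloring N k) → Gallai c → ∃ λ i → MonoCopy c i (H i)

GR≥ : ∀ {k} → (Fin k → Graph) → ℕ → Set
GR≥ H M = ∀ N → GRProperty H N → M ≤ N

Gfam : (n : ℕ) → Bool → ℕ → Graph
Gfam n b i = if does (i <? n ∸ 1) then Path (2 * i + 3)
             else (if b then Cycle (2 * n) else Path (2 * n + 1))

-- Split the vertices of K_N, N < |G_{i₁}| + i₂ + ⋯ + i_k, into consecutive blocks B₁, …, B_k with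
-- |B₁| = |G_{i₁}| − 1 and |B_j| = i_j for j ≥ 2, and colour an edge by the larger block index of
-- its ends.  Such a colouring has no rainbow triangle, since the largest index among three vertices
-- occurs on two sides of their triangle.  Every vertex of a copy of G_{i₁} in colour 1 lies in B₁,
-- which is too small.  An edge of colour j has an end in B_j, and G_{i_j} contains a matching of
-- i_j + 1 edges, so a copy of G_{i_j} in colour j would need i_j + 1 vertices in B_j.
module Submission where

open import Defs hiding (sym)
open import Data.Nat using (ℕ; zero; suc; _<ᵇ_; _+_; _*_; _∸_; _≤_; _<_; z≤n; s≤s; s≤s⁻¹)
open import Data.Nat.Properties
  using (_≤?_; <⇒<ᵇ; <⇒≱; ≮⇒≥; ≰⇒>; 1+n≰n; n≤1+n; m≤m+n; n≤0⇒n≡0; m+[n∸m]≡n; ∸-monoʳ-<;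
         ≤-refl; ≤-trans; ≤-antisym; +-comm; +-suc; *-suc; *-comm; *-monoʳ-≤; +-monoʳ-≤;
         module ≤-Reasoning)
open import Data.Fin using (Fin; toℕ; fromℕ<; inject≤; splitAt; _↑ˡ_; _↑ʳ_; combine)
  renaming (zero to fzero; suc to fsuc; _≤_ to _≤ᶠ_)
open import Data.Fin.Patterns using (0F; 1F)
open import Data.Fin.Properties
  using (≤-totalOrder; toℕ-injective; toℕ-fromℕ<; toℕ<n; toℕ-inject≤; inject≤-injective;
         injective⇒≤; combine-injective; toℕ-combine; splitAt⁻¹-↑ˡ; splitAt⁻¹-↑ʳ)
open import Data.Bool using (Bool; true; false; T)
open import Data.List using (tabulate)
open import Data.Nat.ListAction using (sum)
open import Data.Vec.Functional using (_∷_)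
open import Data.Product using (Σ; ∃; _×_; _,_; proj₁; proj₂; map)
open import Data.Product.Properties using (×-≡,≡→≡; Σ-≡,≡→≡)
open import Data.Sum using (_⊎_; inj₁; inj₂; [_,_]′)
open import Data.Empty using (⊥-elim)
open import Function using (_∘_; id)
open import Function.Definitions using (Injective)
open import Relation.Nullary using (¬_; yes; no)
open import Relation.Binary.PropositionalEquality
  using (_≡_; refl; sym; trans; cong; subst; module ≡-Reasoning)

HasSpanningPath : Graph → Set
HasSpanningPath H = ∀ u v → toℕ v ≡ suc (toℕ u) → Edge H u v

NoIsolatedVertex : Graph → Set
NoIsolatedVertex H = ∀ u → ∃ λ v → Edge H u v ⊎ Edge H v u

record Matching (H : Graph) (t : ℕ) : Set where
  field
    ends           : Fin t × Fin 2 → Fin (order H)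
    ends-injective : Injective _≡_ _≡_ ends
    matched        : ∀ r → Edge H (ends (r , 0F)) (ends (r , 1F))

spanningPath⇒noIsolatedVertex : ∀ {H} → HasSpanningPath H → 2 ≤ order H → NoIsolatedVertex H
spanningPath⇒noIsolatedVertex {H} path 2≤∣H∣ u with toℕ u in u≡
... | zero  = fromℕ< 2≤∣H∣ , inj₁ (path u _ (trans (toℕ-fromℕ< 2≤∣H∣) (cong suc (sym u≡))))
... | suc w = fromℕ< w<∣H∣ , inj₂ (path _ u (trans u≡ (cong suc (sym (toℕ-fromℕ< w<∣H∣)))))
  where
  w<∣H∣ : w < order H
  w<∣H∣ = ≤-trans (n≤1+n (suc w)) (subst (_< order H) u≡ (toℕ<n u))

-- The r-th edge of the matching joins the path vertices 2r and 2r + 1.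
spanningPath⇒matching : ∀ {H t} → HasSpanningPath H → 2 * t ≤ order H → Matching H t
spanningPath⇒matching {H} {t} path 2t≤∣H∣ = record
  { ends           = ends
  ; ends-injective = λ { {r , s} {r′ , s′} e →
      ×-≡,≡→≡ (combine-injective r s r′ s′ (inject≤-injective _ _ _ _ e)) }
  ; matched        = λ r → path _ _ (toℕ-ends r)
  }
  where
  t*2≤∣H∣ : t * 2 ≤ order H
  t*2≤∣H∣ = subst (_≤ order H) (*-comm 2 t) 2t≤∣H∣
  ends : Fin t × Fin 2 → Fin (order H)
  ends (r , s) = inject≤ (combine r s) t*2≤∣H∣
  toℕ-ends : ∀ r → toℕ (ends (r , 1F)) ≡ suc (toℕ (ends (r , 0F)))
  toℕ-ends r = begin
    toℕ (ends (r , 1F))           ≡⟨ toℕ-inject≤ (combine r 1F) t*2≤∣H∣ ⟩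
    toℕ (combine r 1F)            ≡⟨ toℕ-combine r 1F ⟩
    2 * toℕ r + 1                 ≡⟨ +-suc (2 * toℕ r) 0 ⟩
    suc (2 * toℕ r + 0)           ≡⟨ cong suc (toℕ-combine r 0F) ⟨
    suc (toℕ (combine r 0F))      ≡⟨ cong suc (toℕ-inject≤ (combine r 0F) t*2≤∣H∣) ⟨
    suc (toℕ (ends (r , 0F)))     ∎
    where open ≡-Reasoning

-- The test  does (i <? n ∸ 1)  in Gfam computes to  i <ᵇ n ∸ 1,  so that is what we case on.
Gfam-hasSpanningPath : ∀ n b i → HasSpanningPath (Gfam n b i)
Gfam-hasSpanningPath n b i with i <ᵇ n ∸ 1 | b
... | true  | _     = λ _ _ → inj₁
... | false | true  = λ _ _ → inj₁ ∘ inj₁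
... | false | false = λ _ _ → inj₁

Gfam-order : ∀ n b i → 1 ≤ n → i ≤ n ∸ 1 → 2 * suc i ≤ order (Gfam n b i)
Gfam-order (suc n) b i _ i≤n with i <ᵇ n in i<ᵇn
... | true = begin
  2 * suc i  ≡⟨ *-suc 2 i ⟩
  2 + 2 * i  ≡⟨ +-comm 2 (2 * i) ⟩
  2 * i + 2  ≤⟨ +-monoʳ-≤ (2 * i) (n≤1+n 2) ⟩
  2 * i + 3  ∎
  where open ≤-Reasoning
... | false rewrite ≤-antisym i≤n (≮⇒≥ (λ i<n → subst T i<ᵇn (<⇒<ᵇ i<n))) with b
...   | true  = ≤-refl
...   | false = m≤m+n (2 * suc n) 1

module _ {k : ℕ} where
  open import Algebra.Construct.NaturalChoice.Max (≤-totalOrder k)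
    using (_⊔_; ⊔-sel; ⊔-comm; x≤x⊔y; x≤y⊔x; x≤y⇒x⊔y≈y; x⊔y≈y⇒x≤y; x⊔y≤z⇒x≤z; x⊔y≤z⇒y≤z)

  ⊔-twoOfThree : ∀ (a b c : Fin k) → a ⊔ b ≡ b ⊔ c ⊎ b ⊔ c ≡ a ⊔ c ⊎ a ⊔ b ≡ a ⊔ c
  ⊔-twoOfThree a b c with ⊔-sel (a ⊔ b) c | ⊔-sel a b
  ... | inj₁ ab⊔c≡ab | inj₁ ab≡a = inj₂ (inj₂ (begin
    a ⊔ b      ≡⟨ ab⊔c≡ab ⟨
    a ⊔ b ⊔ c  ≡⟨ cong (_⊔ c) ab≡a ⟩
    a ⊔ c      ∎))
    where open ≡-Reasoning
  ... | inj₁ ab⊔c≡ab | inj₂ ab≡b = inj₁ (begin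
    a ⊔ b      ≡⟨ ab⊔c≡ab ⟨
    a ⊔ b ⊔ c  ≡⟨ cong (_⊔ c) ab≡b ⟩
    b ⊔ c      ∎)
    where open ≡-Reasoning
  ... | inj₂ ab⊔c≡c | _ = inj₂ (inj₁ (trans (x≤y⇒x⊔y≈y b≤c) (sym (x≤y⇒x⊔y≈y a≤c))))
    where
    ab≤c : a ⊔ b ≤ᶠ c
    ab≤c = x⊔y≈y⇒x≤y ab⊔c≡c
    a≤c : a ≤ᶠ c
    a≤c = x⊔y≤z⇒x≤z a b ab≤c
    b≤c : b ≤ᶠ c
    b≤c = x⊔y≤z⇒y≤z a b ab≤c

  maxColoring : ∀ {N} → (Fin N → Fin k) → Coloring N k
  maxColoring level = record
    { col = λ x y → level x ⊔ level y
    ; sym = λ x y → ⊔-comm (level x) (level y)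
    }

  maxColoring-gallai : ∀ {N} (level : Fin N → Fin k) → Gallai (maxColoring level)
  maxColoring-gallai level (x , y , z , _ , _ , _ , xy≢yz , yz≢xz , xy≢xz) =
    [ xy≢yz , [ yz≢xz , xy≢xz ]′ ]′ (⊔-twoOfThree (level x) (level y) (level z))

  maxColoring-copy-level≤ : ∀ {N H j} (level : Fin N → Fin k) → NoIsolatedVertex H →
                            (copy : MonoCopy (maxColoring level) j H) → ∀ u → level (proj₁ copy u) ≤ᶠ j
  maxColoring-copy-level≤ level noIsolated (f , _ , edges) u with noIsolated u
  ... | v , inj₁ uv = subst (level (f u) ≤ᶠ_) (edges u v uv) (x≤x⊔y (level (f u)) (level (f v)))
  ... | v , inj₂ vu = subst (level (f u) ≤ᶠ_) (edges v u vu) (x≤y⊔x (level (f v)) (level (f u)))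

  maxColoring-copy-matching : ∀ {N H j t} (level : Fin N → Fin k) → Matching H t →
                              MonoCopy (maxColoring level) j H →
                              Σ (Fin t → Fin N) λ g → Injective _≡_ _≡_ g × ∀ r → level (g r) ≡ j
  maxColoring-copy-matching {N} {H} {j} {t} level M (f , f-injective , edges) =
    g , g-injective , proj₂ ∘ endAtLevel
    where
    open Matching M
    endAtLevel : ∀ r → Σ (Fin 2) λ s → level (f (ends (r , s))) ≡ j
    endAtLevel r with ⊔-sel (level (f (ends (r , 0F)))) (level (f (ends (r , 1F))))
    ... | inj₁ e = 0F , trans (sym e) (edges _ _ (matched r))
    ... | inj₂ e = 1F , trans (sym e) (edges _ _ (matched r))
    g : Fin t → Fin N
    g r = f (ends (r , proj₁ (endAtLevel r)))
    g-injective : Injective _≡_ _≡_ g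
    g-injective e = cong proj₁ (ends-injective (f-injective e))

fiber-size≤ : ∀ {N k m} {sizes : Fin k → ℕ} (d : Fin N → Σ (Fin k) (Fin ∘ sizes)) →
              Injective _≡_ _≡_ d → ∀ {j} (g : Fin m → Fin N) → Injective _≡_ _≡_ g →
              (∀ u → proj₁ (d (g u)) ≡ j) → m ≤ sizes j
fiber-size≤ {sizes = sizes} d d-injective {j} g g-injective atLevel = injective⇒≤ offset-injective
  where
  offset : ∀ u → Fin (sizes j)
  offset u = subst (Fin ∘ sizes) (atLevel u) (proj₂ (d (g u)))
  d∘g≡ : ∀ u → d (g u) ≡ (j , offset u)
  d∘g≡ u = Σ-≡,≡→≡ (atLevel u , refl)
  offset-injective : Injective _≡_ _≡_ offset
  offset-injective {u} {u′} e =
    g-injective (d-injective (trans (d∘g≡ u) (trans (cong (j ,_) e) (sym (d∘g≡ u′)))))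

blocks : ∀ {k} (sizes : Fin k → ℕ) → Fin (sum (tabulate sizes)) → Σ (Fin k) (Fin ∘ sizes)
blocks {suc k} sizes x with splitAt (sizes 0F) x
... | inj₁ y = 0F , y
... | inj₂ z = map fsuc id (blocks (sizes ∘ fsuc) z)

unblock : ∀ {k} (sizes : Fin k → ℕ) → Σ (Fin k) (Fin ∘ sizes) → Fin (sum (tabulate sizes))
unblock {suc k} sizes (0F     , y) = y ↑ˡ sum (tabulate (sizes ∘ fsuc))
unblock {suc k} sizes (fsuc j , y) = sizes 0F ↑ʳ unblock (sizes ∘ fsuc) (j , y)

unblock-blocks : ∀ {k} (sizes : Fin k → ℕ) x → unblock sizes (blocks sizes x) ≡ x
unblock-blocks {suc k} sizes x with splitAt (sizes 0F) x in split≡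
... | inj₁ y = splitAt⁻¹-↑ˡ split≡
... | inj₂ z = trans (cong (sizes 0F ↑ʳ_) (unblock-blocks (sizes ∘ fsuc) z)) (splitAt⁻¹-↑ʳ split≡)

blocks-injective : ∀ {k} (sizes : Fin k → ℕ) → Injective _≡_ _≡_ (blocks sizes)
blocks-injective sizes {x} {y} e =
  trans (sym (unblock-blocks sizes x)) (trans (cong (unblock sizes) e) (unblock-blocks sizes y))

AvoidingGallaiColoring : ∀ {k} → (Fin k → Graph) → ℕ → Set
AvoidingGallaiColoring {k} H N = Σ (Coloring N k) λ c → Gallai c × ∀ i → ¬ MonoCopy c i (H i)

GR≥-fromAvoiding : ∀ {k} {H : Fin k → Graph} {M} → (∀ {N} → N < M → AvoidingGallaiColoring H N) → GR≥ H M
GR≥-fromAvoiding {M = M} avoiding N hasGR with M ≤? N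
... | yes M≤N = M≤N
... | no M≰N with avoiding (≰⇒> M≰N)
... | c , gallai , avoids with hasGR c gallai
... | i , copy = ⊥-elim (avoids i copy)

blockColoring-avoiding : ∀ {k N} (H : Fin (suc k) → Graph) (sizes : Fin (suc k) → ℕ) → N ≤ sum (tabulate sizes) →
                         NoIsolatedVertex (H 0F) → sizes 0F < order (H 0F) →
                         (∀ j → Matching (H (fsuc j)) (suc (sizes (fsuc j)))) → AvoidingGallaiColoring H N
blockColoring-avoiding {k} {N} H sizes N≤ noIsolated small matching =
  maxColoring level , maxColoring-gallai level , avoids
  where
  block : Fin N → Σ (Fin (suc k)) (Fin ∘ sizes)
  block x = blocks sizes (inject≤ x N≤)
  block-injective : Injective _≡_ _≡_ block
  block-injective e = inject≤-injective _ _ _ _ (blocks-injective sizes e)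
  level : Fin N → Fin (suc k)
  level = proj₁ ∘ block
  avoids : ∀ i → ¬ MonoCopy (maxColoring level) i (H i)
  avoids 0F copy@(f , f-injective , _) =
    <⇒≱ small (fiber-size≤ block block-injective f f-injective
                (λ u → toℕ-injective (n≤0⇒n≡0 (maxColoring-copy-level≤ level noIsolated copy u))))
  avoids (fsuc j) copy with maxColoring-copy-matching level (matching j) copy
  ... | g , g-injective , atLevel = 1+n≰n (fiber-size≤ block block-injective g g-injective atLevel)

proposition1p12 : (n : ℕ) → 3 ≤ n → (k′ : ℕ) → 1 ≤ k′ → (b : Bool)
    → (ι : Fin (suc k′) → ℕ)
    → ι fzero ≤ n ∸ 1
    → (∀ (a a′ : Fin (suc k′)) → a ≤ᶠ a′ → ι a′ ≤ ι a)
    → GR≥ (λ j → Gfam n b (ι j))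
          (Graph.order (Gfam n b (ι fzero)) + sum (tabulate {n = k′} (λ j → ι (fsuc j))))
proposition1p12 n 3≤n k′ _ b ι ι₀≤ ι-antitone = GR≥-fromAvoiding λ N<M →
  blockColoring-avoiding G sizes (≤-sizes N<M)
    (spanningPath⇒noIsolatedVertex (spanning 0F) (≤-trans (*-monoʳ-≤ 2 (s≤s z≤n)) (∣G∣ 0F)))
    (∸-monoʳ-< (s≤s z≤n) 1≤∣G₀∣)
    (λ j → spanningPath⇒matching (spanning (fsuc j)) (∣G∣ (fsuc j)))
  where
  G : Fin (suc k′) → Graph
  G j = Gfam n b (ι j)
  spanning : ∀ j → HasSpanningPath (G j)
  spanning j = Gfam-hasSpanningPath n b (ι j)
  ∣G∣ : ∀ j → 2 * suc (ι j) ≤ order (G j)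
  ∣G∣ j = Gfam-order n b (ι j) (≤-trans (s≤s z≤n) 3≤n) (≤-trans (ι-antitone 0F j z≤n) ι₀≤)
  1≤∣G₀∣ : 1 ≤ order (G 0F)
  1≤∣G₀∣ = ≤-trans (s≤s z≤n) (∣G∣ 0F)
  sizes : Fin (suc k′) → ℕ
  sizes = (order (G 0F) ∸ 1) ∷ (ι ∘ fsuc)
  ≤-sizes : ∀ {N} → N < order (G 0F) + sum (tabulate (ι ∘ fsuc)) → N ≤ sum (tabulate sizes)
  ≤-sizes {N} N<M = s≤s⁻¹ (subst (N <_) (cong (_+ _) (sym (m+[n∸m]≡n 1≤∣G₀∣))) N<M)
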